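{- Let $A$ be a finite set of actions equipped with an involution $\mathrm{dual}_A : A \to A$. Let $\mathcal{L}$ and $\mathcal{M}$ be disjoint finite sets of locations, let $\mathbf{A}$ be an $\mathcal{L}_A$-LTS, let $\mathbf{B}$ be an $\mathcal{M}_A$-LTS, and let $\sigma$ be a partial injection from $\mathcal{L}$ to $\mathcal{M}$, with inverse partial injection $\sigma^{ -1}$ from $\mathcal{M}$ to $\mathcal{L}$. Then $\mathbf{A}\,||_{\sigma}\,\mathbf{B} \sim \mathbf{B}\,||_{\sigma^{ -1}}\,\mathbf{A}$, i.e. the two parallel compositions are strongly bisimilar.
   Context: For a set $X$, $\mathbb{FM}(X)$ denotes the set of finite multisets over $X$; multiset union $\cup$ adds multiplicities. For a finite set of locations $\mathcal{L}$, $\mathcal{L}_A$ denotes $\mathbb{FM}(\mathcal{L}\times A)$. An $\mathcal{L}_A$-LTS (locative transition system) is a triple $\mathbf{A}=(S_\mathbf{A},\rightarrow_\mathbf{A},s_\mathbf{A})$ with a set of states $S_\mathbf{A}$, an initial state $s_\mathbf{A}\in S_\mathbf{A}$, and a transition relation $\rightarrow_\mathbf{A}\subseteq S_\mathbf{A}\times\mathcal{L}_A\times S_\mathbf{A}$; write $u\xrightarrow{\mathsf a}t$ for $(u,\mathsf a,t)\in\rightarrow_\mathbf{A}$. Given disjoint $\mathcal{L},\mathcal{M}$ and a partial injection $\sigma$ from $\mathcal{L}$ to $\mathcal{M}$ (a bijection $\mathrm{dom}(\sigma)\to\mathrm{rng}(\sigma)$ with $\mathrm{dom}(\sigma)\subseteq\mathcal{L}$,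 $\mathrm{rng}(\sigma)\subseteq\mathcal{M}$), a multiset over $(\mathcal{L}\cup\mathcal{M})\times A$ is $\sigma$-dual if it has the form $\{\!|(\ell_1,a_1),\dots,(\ell_n,a_n),(\sigma(\ell_1),b_1),\dots,(\sigma(\ell_n),b_n)|\!\}$ with $\ell_i\in\mathrm{dom}(\sigma)$ and $b_i=\mathrm{dual}_A(a_i)$ for all $i$; the set of these is $\bot_\sigma$. The $\sigma$-parallel composition $\mathbf{A}\,||_\sigma\,\mathbf{B}$ of an $\mathcal{L}_A$-LTS $\mathbf{A}$ and an $\mathcal{M}_A$-LTS $\mathbf{B}$ is the $\mathcal{N}_A$-LTS with $\mathcal{N}=(\mathcal{L}\cup\mathcal{M})\setminus(\mathrm{dom}(\sigma)\cup\mathrm{rng}(\sigma))$, states $S_\mathbf{A}\times S_\mathbf{B}$, initial state $(s_\mathbf{A},s_\mathbf{B})$, and transitions $\leadsto$ the union of: (i) $(u_\mathbf{A},u_\mathbf{B})\overset{\mathsf a}{\leadsto}(t_\mathbf{A},u_\mathbf{B})$ whenever $\mathsf a\in(\mathcal{L}\setminus\mathrm{dom}(\sigma))_A$ and $u_\mathbf{A}\xrightarrow{\mathsf a}t_\mathbf{A}$ in $\mathbf{A}$; (ii) $(u_\mathbf{A},u_\mathbf{B})\overset{\mathsf a}{\leadsto}(u_\mathbf{A},t_\mathbf{B})$ whenever $\mathsf a\in(\mathcal{M}\setminus\mathrm{rng}(\sigma))_A$ and $u_\mathbf{B}\xrightarrow{\mathsf a}t_\mathbf{B}$ in $\mathbf{B}$;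 (iii) $(u_\mathbf{A},u_\mathbf{B})\overset{\mathsf a}{\leadsto}(t_\mathbf{A},t_\mathbf{B})$ whenever there are $\mathsf d\in\bot_\sigma$, $\mathsf b\in\mathcal{L}_A$, $\mathsf c\in\mathcal{M}_A$ with $u_\mathbf{A}\xrightarrow{\mathsf b}t_\mathbf{A}$, $u_\mathbf{B}\xrightarrow{\mathsf c}t_\mathbf{B}$ and $\mathsf a\cup\mathsf d=\mathsf b\cup\mathsf c$. A (strong) bisimulation between two LTSs $\mathbf{A},\mathbf{B}$ over the same label set is a relation $\mathcal{R}\subseteq S_\mathbf{A}\times S_\mathbf{B}$ with $s_\mathbf{A}\,\mathcal{R}\,s_\mathbf{B}$ such that whenever $u\,\mathcal{R}\,t$: if $u\xrightarrow{\mathsf a}v$ then $t\xrightarrow{\mathsf a}w$ for some $w$ with $v\,\mathcal{R}\,w$, and if $t\xrightarrow{\mathsf a}w$ then $u\xrightarrow{\mathsf a}v$ for some $v$ with $v\,\mathcal{R}\,w$. $\mathbf{A}\sim\mathbf{B}$ means such a bisimulation exists. -}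

module Defs where

open import Data.Nat using (ℕ; zero; suc; _+_)
open import Data.Maybe using (Maybe; just; nothing)
open import Data.Product using (Σ; ∃; _×_; _,_)
open import Data.List using (List; []; _∷_)
open import Data.List.Membership.Propositional using (_∈_)
open import Data.List.Relation.Unary.All using (All)
open import Relation.Nullary using (¬_; does)
open import Relation.Binary.Definitions using (DecidableEquality)
open import Relation.Binary.PropositionalEquality using (_≡_; _≢_)
open import Data.Bool using (if_then_else_; _∧_)
open import Level using (suc; zero)

-- Locations are drawn from an ambient type Loc with decidable equality;
-- a finite set of locations is given by a list of its elements.
-- A finite multiset over Loc × Act is represented by its multiplicity
-- function  Loc → Act → ℕ  (its support is always constrained to a finite
-- set of locations times the finite set Act, hence finite).
-- Multiset union is pointwise addition.

MS : Set → Set → Set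
MS Loc Act = Loc → Act → ℕ

SupportedIn : {Loc Act : Set} → (Loc → Set) → MS Loc Act → Set
SupportedIn P m = ∀ l x → m l x ≢ 0 → P l

Finite : Set → Set
Finite X = Σ (List X) (λ xs → ∀ x → x ∈ xs)

record LTS (Loc Act : Set) : Set₁ where
  field
    State : Set
    init  : State
    _⟶[_]_ : State → MS Loc Act → State → Set
open LTS public

IsLTSOver : {Loc Act : Set} → List Loc → LTS Loc Act → Set
IsLTSOver L T = ∀ u a t → LTS._⟶[_]_ T u a t → SupportedIn (λ l → l ∈ L) a

record PartialInjection {Loc : Set} (L M : List Loc) : Set where
  field
    fun  : Loc → Maybe Loc
    dom⊆ : ∀ l m → fun l ≡ just m → l ∈ L
    rng⊆ : ∀ l m → fun l ≡ just m → m ∈ M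
    inj  : ∀ l l' m → fun l ≡ just m → fun l' ≡ just m → l ≡ l'
open PartialInjection public

IsInverse : {Loc : Set} {L M : List Loc} →
            PartialInjection L M → PartialInjection M L → Set
IsInverse {Loc} σ τ = ∀ (l m : Loc) → (fun σ l ≡ just m → fun τ m ≡ just l)
                                      × (fun τ m ≡ just l → fun σ l ≡ just m)

module _ {Loc : Set} (_≟L_ : DecidableEquality Loc)
         {Act : Set} (_≟A_ : DecidableEquality Act)
         (dual : Act → Act) where

  sing : Loc → Act → MS Loc Act
  sing ℓ a l x = if does (ℓ ≟L l) ∧ does (a ≟A x) then 1 else 0

  dualMS : List (Loc × Act × Loc) → MS Loc Act
  dualMS [] l x = 0
  dualMS ((ℓ , a , m) ∷ ps) l x = sing ℓ a l x + sing m (dual a) l x + dualMS ps l x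

  IsDual : {L M : List Loc} → PartialInjection L M → MS Loc Act → Set
  IsDual σ d = Σ (List (Loc × Act × Loc)) λ ps →
                 All (λ { (ℓ , a , m) → fun σ ℓ ≡ just m }) ps
               × (∀ l x → d l x ≡ dualMS ps l x)

  module Compose {L M : List Loc} (σ : PartialInjection L M)
                 (A B : LTS Loc Act) where

    InLnotDom : Loc → Set
    InLnotDom l = l ∈ L × fun σ l ≡ nothing

    InMnotRng : Loc → Set
    InMnotRng l = l ∈ M × (¬ ∃ λ ℓ → fun σ ℓ ≡ just l)

    data Step : State A × State B → MS Loc Act → State A × State B → Set where
      left  : ∀ {uA uB tA a} → SupportedIn InLnotDom a →
              LTS._⟶[_]_ A uA a tA → Step (uA , uB) a (tA , uB)
      right : ∀ {uA uB tB a} → SupportedIn InMnotRng a →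
              LTS._⟶[_]_ B uB a tB → Step (uA , uB) a (uA , tB)
      sync  : ∀ {uA uB tA tB a} (d b c : MS Loc Act) →
              IsDual σ d → SupportedIn (λ l → l ∈ L) b →
              SupportedIn (λ l → l ∈ M) c →
              LTS._⟶[_]_ A uA b tA → LTS._⟶[_]_ B uB c tB →
              (∀ l x → a l x + d l x ≡ b l x + c l x) →
              Step (uA , uB) a (tA , tB)

    composed : LTS Loc Act
    composed = record { State = State A × State B
                      ; init = (init A , init B)
                      ; _⟶[_]_ = Step }

  _∥[_]_ : LTS Loc Act → {L M : List Loc} → PartialInjection L M →
           LTS Loc Act → LTS Loc Act
  A ∥[ σ ] B = Compose.composed σ A B

record Bisimulation {Loc Act : Set} (X Y : LTS Loc Act)
                    (R : State X → State Y → Set) : Set where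
  field
    initR : R (init X) (init Y)
    forth : ∀ {u t a v} → R u t → LTS._⟶[_]_ X u a v →
            ∃ λ w → LTS._⟶[_]_ Y t a w × R v w
    back  : ∀ {u t a w} → R u t → LTS._⟶[_]_ Y t a w →
            ∃ λ v → LTS._⟶[_]_ X u a v × R v w

_∼_ : {Loc Act : Set} → LTS Loc Act → LTS Loc Act → Set₁
X ∼ Y = Σ (State X → State Y → Set) (Bisimulation X Y)

{-# OPTIONS --safe #-}
module Submission where

open import Defs
open import Data.List using (List; []; _∷_; map)
open import Data.List.Membership.Propositional using (_∈_)
open import Data.List.Relation.Unary.All using (All; []; _∷_)
open import Data.Maybe using (just; nothing)
open import Data.Nat using (_+_)
open import Data.Nat.Properties using (+-comm)
open import Data.Product using (∃; _×_; _,_; proj₁; proj₂; swap)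
open import Relation.Nullary using (¬_)
open import Relation.Binary.Definitions using (DecidableEquality)
open import Relation.Binary.PropositionalEquality using (_≡_; refl; sym; trans; cong₂)

-- Swapping the two components of a state is a bisimulation: a local step of
-- A (resp. B) stays a local step, and a synchronisation through σ is one
-- through σ⁻¹, because a σ-dual multiset, read with every pair (ℓ , a , σ ℓ)
-- flipped to (σ ℓ , dual a , ℓ), is σ⁻¹-dual (dual being an involution).

IsInverse-sym : {Loc : Set} {L M : List Loc}
                (σ : PartialInjection L M) (τ : PartialInjection M L) →
                IsInverse σ τ → IsInverse τ σ
IsInverse-sym _ _ σ⁻¹≡τ m l = swap (σ⁻¹≡τ l m)

module _ {Loc : Set} {L M : List Loc}
         (σ : PartialInjection L M) (τ : PartialInjection M L)
         (σ⁻¹≡τ : IsInverse σ τ) where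

  ∉dom⇒∉rng-inverse : ∀ {l} → fun σ l ≡ nothing → ¬ ∃ λ m → fun τ m ≡ just l
  ∉dom⇒∉rng-inverse {l} σl≡nothing (m , τm≡l)
    with () ← trans (sym σl≡nothing) (proj₂ (σ⁻¹≡τ l m) τm≡l)

  ∉rng⇒∉dom-inverse : ∀ {m} → ¬ (∃ λ l → fun σ l ≡ just m) → fun τ m ≡ nothing
  ∉rng⇒∉dom-inverse {m} m∉rng with fun τ m in τm≡
  ... | nothing = refl
  ... | just l with () ← m∉rng (l , proj₂ (σ⁻¹≡τ l m) τm≡)

module _ {Loc : Set} (_≟L_ : DecidableEquality Loc)
         {Act : Set} (_≟A_ : DecidableEquality Act)
         (dual : Act → Act) (dual-involutive : ∀ a → dual (dual a) ≡ a) where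

  flipPair : Loc × Act × Loc → Loc × Act × Loc
  flipPair (ℓ , a , m) = m , dual a , ℓ

  dualMS-map-flipPair : ∀ ps l x →
    dualMS _≟L_ _≟A_ dual (map flipPair ps) l x ≡ dualMS _≟L_ _≟A_ dual ps l x
  dualMS-map-flipPair [] l x = refl
  dualMS-map-flipPair ((ℓ , a , m) ∷ ps) l x rewrite dual-involutive a =
    cong₂ _+_ (+-comm (sing _≟L_ _≟A_ dual m (dual a) l x) (sing _≟L_ _≟A_ dual ℓ a l x))
              (dualMS-map-flipPair ps l x)

  module _ {L M : List Loc} (σ : PartialInjection L M) (τ : PartialInjection M L)
           (σ⁻¹≡τ : IsInverse σ τ) where

    IsDual-inverse : ∀ {d} → IsDual _≟L_ _≟A_ dual σ d → IsDual _≟L_ _≟A_ dual τ d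
    IsDual-inverse (ps , ps⊆σ , d≡ps) =
      map flipPair ps , flip-⊆ ps ps⊆σ ,
      λ l x → trans (d≡ps l x) (sym (dualMS-map-flipPair ps l x))
      where
        flip-⊆ : ∀ ps → All (λ { (ℓ , a , m) → fun σ ℓ ≡ just m }) ps →
                 All (λ { (ℓ , a , m) → fun τ ℓ ≡ just m }) (map flipPair ps)
        flip-⊆ [] [] = []
        flip-⊆ ((ℓ , a , m) ∷ ps) (σℓ≡m ∷ ps⊆σ) = proj₁ (σ⁻¹≡τ ℓ m) σℓ≡m ∷ flip-⊆ ps ps⊆σ

    swap-Step : (A B : LTS Loc Act) → ∀ {u a v} →
                Compose.Step _≟L_ _≟A_ dual σ A B u a v →
                Compose.Step _≟L_ _≟A_ dual τ B A (swap u) a (swap v)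
    swap-Step A B (Compose.left a⊆L∖dom u⟶v) =
      Compose.right (λ l x ax≢0 → let l∈L , l∉dom = a⊆L∖dom l x ax≢0 in
                                  l∈L , ∉dom⇒∉rng-inverse σ τ σ⁻¹≡τ l∉dom)
                    u⟶v
    swap-Step A B (Compose.right a⊆M∖rng u⟶v) =
      Compose.left (λ l x ax≢0 → let l∈M , l∉rng = a⊆M∖rng l x ax≢0 in
                                 l∈M , ∉rng⇒∉dom-inverse σ τ σ⁻¹≡τ l∉rng)
                   u⟶v
    swap-Step A B (Compose.sync d b c d-dual b⊆L c⊆M uA⟶vA uB⟶vB a+d≡b+c) =
      Compose.sync d c b (IsDual-inverse d-dual) c⊆M b⊆L uB⟶vB uA⟶vA
                   (λ l x → trans (a+d≡b+c l x) (+-comm (b l x) (c l x)))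

  swap-bisimulation : {L M : List Loc} (σ : PartialInjection L M) (τ : PartialInjection M L) →
                      IsInverse σ τ → (A B : LTS Loc Act) →
                      Bisimulation (_∥[_]_ _≟L_ _≟A_ dual A σ B) (_∥[_]_ _≟L_ _≟A_ dual B τ A)
                                   (λ p q → q ≡ swap p)
  swap-bisimulation σ τ σ⁻¹≡τ A B = record
    { initR = refl
    ; forth = λ { refl p⟶p′ → _ , swap-Step σ τ σ⁻¹≡τ A B p⟶p′ , refl }
    ; back  = λ { refl q⟶q′ → _ , swap-Step τ σ (IsInverse-sym σ τ σ⁻¹≡τ) B A q⟶q′ , refl }
    }

mainTheorem1 : {Loc : Set} (_≟L_ : DecidableEquality Loc)
               {Act : Set} (_≟A_ : DecidableEquality Act) → Finite Act →
               (dual : Act → Act) → (∀ a → dual (dual a) ≡ a) →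
               (L M : List Loc) → (∀ l → l ∈ L → ¬ (l ∈ M)) →
               (A B : LTS Loc Act) → IsLTSOver L A → IsLTSOver M B →
               (σ : PartialInjection L M) (σ⁻¹ : PartialInjection M L) →
               IsInverse σ σ⁻¹ →
               (_∥[_]_ _≟L_ _≟A_ dual A σ B) ∼ (_∥[_]_ _≟L_ _≟A_ dual B σ⁻¹ A)
mainTheorem1 _≟L_ _≟A_ _ dual dual-involutive _ _ _ A B _ _ σ σ⁻¹ inverse =
  _ , swap-bisimulation _≟L_ _≟A_ dual dual-involutive σ σ⁻¹ inverse A B
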